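{- Let $n\ge1$, $\pi\in\mathfrak S_n(123)$ and $\sigma\in\mathfrak S_n(132)$. Then $\mathrm{Kr}(\pi)=\sigma$ if and only if for all $i,a\in\{1,\dots,n\}$: $$(n+1-i,a)\in\mathrm{RMAX}(\pi)\iff(n+1-a,i)\in\mathrm{LMIN}(\sigma).$$
   Context: Permutations are words $a_1\dots a_n$ with $a_i=\pi(i)$; $\mathfrak S_n(\tau)$ is the set of $\tau$-avoiding permutations ($123$: no $i<j<k$ with $a_i<a_j<a_k$; $132$: no $i<j<k$ with $a_i<a_k<a_j$). $\mathrm{LMIN}(\pi)=\{(i,a_i): a_i<a_j\ \forall j<i\}$ and $\mathrm{RMAX}(\pi)=\{(i,a_i): a_i>a_j\ \forall j>i\}$. $\mathcal D_n$ denotes Dyck paths of semilength $n$ as words in $u,d$. The standard bijection $f:\mathfrak S_n(132)\to\mathcal D_n$ is defined recursively (on $132$-avoiding words of distinct integers, depending only on relative order) by $f(\epsilon)=\epsilon$ and $f(\pi_L\,m\,\pi_R)=u\,f(\pi_L)\,d\,f(\pi_R)$ where $m$ is the largest letter. Krattenthaler's map $K:\mathfrak S_n(123)\to\mathcal D_n$: write the right-to-left maxima of $\pi$, read right to left, as $m_1,\dots,m_s$, so $\pi=w_sm_s\dots w_1m_1$; reading $\pi$ from right to left, translate each $m_j$ into $m_j-m_{j-1}$ up-steps ($m_0=0$) and each $w_j$ into $|w_j|+1$ down-steps; then reflect the resulting path in a vertical line (reverse the word and interchange $u,d$). Krattenthaler's bijection is $\mathrm{Kr}=f^{ -1}\circ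 K:\mathfrak S_n(123)\to\mathfrak S_n(132)$. -}

module Defs where

open import Data.Nat using (ℕ; zero; suc; _+_; _∸_; _<_; _≤_; _⊔_; _<ᵇ_; _≡ᵇ_)
open import Data.Bool using (Bool; true; false; if_then_else_)
open import Data.List using (List; []; _∷_; _++_; length; reverse; map; upTo; replicate; foldr)
open import Data.List.Relation.Binary.Permutation.Propositional using (_↭_)
open import Data.Fin using (Fin; toℕ)
import Data.Fin as F
open import Data.List using (lookup)
open import Data.Product using (_×_; _,_; ∃-syntax)
open import Relation.Binary.PropositionalEquality using (_≡_)
open import Relation.Nullary using (¬_)

IsPerm : ℕ → List ℕ → Set
IsPerm n w = w ↭ map suc (upTo n)

Avoids123 : List ℕ → Set
Avoids123 w = (i j k : Fin (length w)) → i F.< j → j F.< k →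
  ¬ (lookup w i < lookup w j × lookup w j < lookup w k)

Avoids132 : List ℕ → Set
Avoids132 w = (i j k : Fin (length w)) → i F.< j → j F.< k →
  ¬ (lookup w i < lookup w k × lookup w k < lookup w j)

-- (i , a) ∈ LMIN(w), with 1-based position i.
LMIN : List ℕ → ℕ → ℕ → Set
LMIN w i a = ∃[ p ] (suc (toℕ p) ≡ i × lookup w p ≡ a ×
  ((q : Fin (length w)) → q F.< p → a < lookup w q))

-- (i , a) ∈ RMAX(w), with 1-based position i.
RMAX : List ℕ → ℕ → ℕ → Set
RMAX w i a = ∃[ p ] (suc (toℕ p) ≡ i × lookup w p ≡ a ×
  ((q : Fin (length w)) → p F.< q → lookup w q < a))

data Step : Set where
  u d : Step

splitAt1 : ℕ → List ℕ → List ℕ × List ℕ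
splitAt1 m [] = [] , []
splitAt1 m (x ∷ xs) with x ≡ᵇ m
... | true = [] , xs
... | false with splitAt1 m xs
...   | (l , r) = (x ∷ l) , r

maxL : List ℕ → ℕ
maxL = foldr _⊔_ 0

-- f(π_L m π_R) = u f(π_L) d f(π_R), m the largest letter; the fuel
-- argument (≥ length) only serves structural termination.
fAux : ℕ → List ℕ → List Step
fAux _ [] = []
fAux zero (_ ∷ _) = []
fAux (suc k) w@(_ ∷ _) with splitAt1 (maxL w) w
... | (l , r) = u ∷ fAux k l ++ d ∷ fAux k r

f : List ℕ → List Step
f w = fAux (length w) w

-- Read π right to left, keeping the
-- current right-to-left maximum c (m₀ = 0).  A new maximum m_j produces
-- m_j − m_{j−1} up-steps, followed by the "+1" down-step belonging to the
-- block w_j that follows m_j in this reading; every letter of w_j produces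
-- one further down-step.  So w_j yields |w_j|+1 down-steps in total.
Kscan : ℕ → List ℕ → List Step
Kscan c [] = []
Kscan c (x ∷ xs) = if c <ᵇ x
  then replicate (x ∸ c) u ++ d ∷ Kscan x xs
  else d ∷ Kscan c xs

flipStep : Step → Step
flipStep u = d
flipStep d = u

reflect : List Step → List Step
reflect p = map flipStep (reverse p)

K : List ℕ → List Step
K π = reflect (Kscan 0 (reverse π))

{-# OPTIONS --safe #-}
module Submission where

-- A word in u, d is determined by its numbers of up- and down-steps and its peaks (x , y): the factors
-- u d whose u is the x-th up-step and whose d is the y-th down-step.  In K π the letter πⱼ contributes
-- the block u d^(πⱼ ∸ max πⱼ₊₁…πₙ), so the peaks of K π are the right-to-left maxima (j , a) of π,
-- placed at (j , n + 1 ∸ a).  In f σ = u f(l) d f(r), where σ = l n r, avoiding 132 puts every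
-- letter of l above every letter of r; by induction the peaks of f σ are the left-to-right minima
-- (i , b) of σ, placed at (n + 1 ∸ b , i), as n + 1 ∸ b letters of σ are ≥ b.  Comparing peaks and
-- substituting x = n + 1 ∸ i, y = n + 1 ∸ a gives the criterion.

open import Defs
open import Data.Bool using (true; false; T)
open import Data.Empty using (⊥; ⊥-elim)
open import Data.Fin using (toℕ) renaming (zero to fzero; suc to fsuc)
import Data.Fin as Fin
open import Data.List
  using (List; []; _∷_; _++_; [_]; _∷ʳ_; length; lookup; map; reverse; replicate; filter; upTo; downFrom)
open import Data.List.Properties
  using ( ++-assoc; length-++; length-map; map-++; reverse-++; unfold-reverse; reverse-upTo; length-downFrom
        ; filter-++; filter-all; filter-none; filter-accept; filter-reject)
open import Data.List.Membership.Propositional using (_∈_)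
open import Data.List.Membership.Propositional.Properties using (∈-lookup; ∈-++⁺ˡ; ∈-++⁺ʳ)
open import Data.List.Relation.Binary.Permutation.Propositional
  using (_↭_; ↭-reflexive; ↭-sym; ↭-trans; ↭⇒↭ₛ)
open import Data.List.Relation.Binary.Permutation.Propositional.Properties
  using (↭-length; ↭-reverse; ∈-resp-↭; map⁺; filter-↭)
import Data.List.Relation.Binary.Permutation.Setoid.Properties as PermutationProperties
open import Data.List.Relation.Unary.All using (All; []; _∷_)
import Data.List.Relation.Unary.All as All
open import Data.List.Relation.Unary.All.Properties using (++⁻ˡ; ++⁻ʳ)
open import Data.List.Relation.Unary.AllPairs using ([]; _∷_)
open import Data.List.Relation.Unary.Any using (here; there; index)
open import Data.List.Relation.Unary.Any.Properties using (lookup-index)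
open import Data.List.Relation.Unary.Unique.Propositional using (Unique)
import Data.List.Relation.Unary.Unique.Propositional.Properties as Unique
open import Data.Nat using (ℕ; zero; suc; _+_; _∸_; _≤_; _<_; _⊔_; z≤n; s≤s; z<s; s<s; _<ᵇ_; _≡ᵇ_; _≤?_)
open import Data.Nat.Properties
open import Data.Product using (_×_; _,_; proj₁; proj₂; ∃; ∃₂; map₂)
open import Data.Sum using (_⊎_; inj₁; inj₂)
open import Data.Unit using (⊤; tt)
open import Function using (_∘_; id)
open import Function.Bundles using (_⇔_; mk⇔; Equivalence)
open import Function.Construct.Composition using (_⇔-∘_)
open import Function.Construct.Symmetry using (⇔-sym)
open import Relation.Binary.PropositionalEquality
  using (_≡_; _≢_; refl; sym; trans; cong; cong₂; subst; subst₂; setoid; module ≡-Reasoning)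
open import Relation.Nullary using (¬_; yes; no)
open import Relation.Nullary.Reflects using (ofʸ; ofⁿ)

-- Step words and their peaks

ups downs : List Step → ℕ
ups [] = 0
ups (u ∷ P) = suc (ups P)
ups (d ∷ P) = ups P
downs [] = 0
downs (u ∷ P) = downs P
downs (d ∷ P) = suc (downs P)

ups-++ : ∀ P Q → ups (P ++ Q) ≡ ups P + ups Q
ups-++ [] Q = refl
ups-++ (u ∷ P) Q = cong suc (ups-++ P Q)
ups-++ (d ∷ P) Q = ups-++ P Q

downs-++ : ∀ P Q → downs (P ++ Q) ≡ downs P + downs Q
downs-++ [] Q = refl
downs-++ (u ∷ P) Q = downs-++ P Q
downs-++ (d ∷ P) Q = cong suc (downs-++ P Q)

ups-downs≡0⇒[] : ∀ P → ups P ≡ 0 → downs P ≡ 0 → P ≡ []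
ups-downs≡0⇒[] [] _ _ = refl
ups-downs≡0⇒[] (u ∷ P) () _
ups-downs≡0⇒[] (d ∷ P) _ ()

data Peak : List Step → ℕ → ℕ → Set where
  peak    : ∀ {P} → Peak (u ∷ d ∷ P) 1 1
  after-u : ∀ {P x y} → Peak P x y → Peak (u ∷ P) (suc x) y
  after-d : ∀ {P x y} → Peak P x y → Peak (d ∷ P) x (suc y)

peak-x-bounds : ∀ {P x y} → Peak P x y → 1 ≤ x × x ≤ ups P
peak-x-bounds peak = s≤s z≤n , s≤s z≤n
peak-x-bounds (after-u p) = s≤s z≤n , s≤s (proj₂ (peak-x-bounds p))
peak-x-bounds (after-d p) = peak-x-bounds p

peak-y-bounds : ∀ {P x y} → Peak P x y → 1 ≤ y × y ≤ downs P
peak-y-bounds peak = s≤s z≤n , s≤s z≤n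
peak-y-bounds (after-u p) = peak-y-bounds p
peak-y-bounds (after-d p) = s≤s z≤n , s≤s (proj₂ (peak-y-bounds p))

after-u⁻ : ∀ {P x y} → Peak (u ∷ P) (suc (suc x)) y → Peak P (suc x) y
after-u⁻ (after-u p) = p

after-d⁻ : ∀ {P x y} → Peak (d ∷ P) x (suc y) → Peak P x y
after-d⁻ (after-d p) = p

peak-at-first-down : ∀ P {k} → downs P ≡ suc k → ∃ λ x → Peak (u ∷ P) x 1
peak-at-first-down (d ∷ P) _ = 1 , peak
peak-at-first-down (u ∷ P) downs≡ with peak-at-first-down P downs≡
... | x , p = suc x , after-u p

no-peak-at-first-down : ∀ {P x} → ¬ Peak (d ∷ P) x 1
no-peak-at-first-down (after-d p) with peak-y-bounds p
... | () , _

peaks-determine : ∀ P Q → ups P ≡ ups Q → downs P ≡ downs Q →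
                  (∀ {x y} → Peak P x y → Peak Q x y) → (∀ {x y} → Peak Q x y → Peak P x y) → P ≡ Q
peaks-determine [] [] _ _ _ _ = refl
peaks-determine (u ∷ P) (u ∷ Q) ups≡ downs≡ P⇒Q Q⇒P =
  cong (u ∷_) (peaks-determine P Q (suc-injective ups≡) downs≡ (unshift P⇒Q) (unshift Q⇒P))
  where
  unshift : ∀ {R S} → (∀ {x y} → Peak (u ∷ R) x y → Peak (u ∷ S) x y) → ∀ {x y} → Peak R x y → Peak S x y
  unshift R⇒S p with peak-x-bounds p
  ... | s≤s z≤n , _ = after-u⁻ (R⇒S (after-u p))
peaks-determine (d ∷ P) (d ∷ Q) ups≡ downs≡ P⇒Q Q⇒P =
  cong (d ∷_) (peaks-determine P Q ups≡ (suc-injective downs≡)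
                (after-d⁻ ∘ P⇒Q ∘ after-d) (after-d⁻ ∘ Q⇒P ∘ after-d))
peaks-determine (u ∷ P) (d ∷ Q) _ downs≡ P⇒Q _ =
  ⊥-elim (no-peak-at-first-down (P⇒Q (proj₂ (peak-at-first-down P downs≡))))
peaks-determine (d ∷ P) (u ∷ Q) _ downs≡ _ Q⇒P =
  ⊥-elim (no-peak-at-first-down (Q⇒P (proj₂ (peak-at-first-down Q (sym downs≡)))))
peaks-determine [] (u ∷ Q) () _ _ _
peaks-determine [] (d ∷ Q) _ () _ _
peaks-determine (u ∷ P) [] () _ _ _
peaks-determine (d ∷ P) [] _ () _ _

≡⇔samePeaks : ∀ P Q → ups P ≡ ups Q → downs P ≡ downs Q → (P ≡ Q) ⇔ (∀ x y → Peak P x y ⇔ Peak Q x y)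
≡⇔samePeaks P Q ups≡ downs≡ = mk⇔
  (λ { refl x y → mk⇔ id id })
  (λ same → peaks-determine P Q ups≡ downs≡ (Equivalence.to (same _ _)) (Equivalence.from (same _ _)))

StartsWithDown : List Step → Set
StartsWithDown (d ∷ _) = ⊤
StartsWithDown _ = ⊥

EndsWithUp : List Step → Set
EndsWithUp [] = ⊥
EndsWithUp (s ∷ []) = s ≡ u
EndsWithUp (_ ∷ t ∷ P) = EndsWithUp (t ∷ P)

endsWithUp-∷ : ∀ s P → EndsWithUp P → EndsWithUp (s ∷ P)
endsWithUp-∷ s (t ∷ P) e = e

endsWithUp-d∷⁻ : ∀ P → EndsWithUp (d ∷ P) → EndsWithUp P
endsWithUp-d∷⁻ (_ ∷ _) e = e

endsWithUp-++⁻ : ∀ P {s Q} → EndsWithUp (P ++ s ∷ Q) → EndsWithUp (s ∷ Q)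
endsWithUp-++⁻ [] e = e
endsWithUp-++⁻ (_ ∷ []) e = e
endsWithUp-++⁻ (_ ∷ t ∷ P) e = endsWithUp-++⁻ (t ∷ P) e

peak-++ˡ : ∀ {P x y} Q → Peak P x y → Peak (P ++ Q) x y
peak-++ˡ Q peak = peak
peak-++ˡ Q (after-u p) = after-u (peak-++ˡ Q p)
peak-++ˡ Q (after-d p) = after-d (peak-++ˡ Q p)

peak-++ʳ : ∀ P {Q x y} → Peak Q x y → Peak (P ++ Q) (ups P + x) (downs P + y)
peak-++ʳ [] q = q
peak-++ʳ (u ∷ P) q = after-u (peak-++ʳ P q)
peak-++ʳ (d ∷ P) q = after-d (peak-++ʳ P q)

-- Without a final up-step in P, no peak straddles the junction of P ++ Q.
peak-++⁻ : ∀ P {Q x y} → ¬ EndsWithUp P → Peak (P ++ Q) x y →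
           Peak P x y ⊎ ∃₂ λ x′ y′ → Peak Q x′ y′ × x ≡ ups P + x′ × y ≡ downs P + y′
peak-++⁻ [] _ q = inj₂ (_ , _ , q , refl , refl)
peak-++⁻ (u ∷ []) ¬end _ = ⊥-elim (¬end refl)
peak-++⁻ (u ∷ d ∷ P) _ peak = inj₁ peak
peak-++⁻ (u ∷ s ∷ P) ¬end (after-u p) with peak-++⁻ (s ∷ P) ¬end p
... | inj₁ p′ = inj₁ (after-u p′)
... | inj₂ (x′ , y′ , q , refl , refl) = inj₂ (x′ , y′ , q , refl , refl)
peak-++⁻ (d ∷ P) ¬end (after-d p) with peak-++⁻ P (¬end ∘ endsWithUp-∷ d P) p
... | inj₁ p′ = inj₁ (after-d p′)
... | inj₂ (x′ , y′ , q , refl , refl) = inj₂ (x′ , y′ , q , refl , refl)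

peak-u∷⁻ : ∀ {P x y} → Peak (u ∷ P) x y →
           (StartsWithDown P × x ≡ 1 × y ≡ 1) ⊎ ∃ λ x′ → x ≡ suc x′ × Peak P x′ y
peak-u∷⁻ peak = inj₁ (_ , refl , refl)
peak-u∷⁻ (after-u p) = inj₂ (_ , refl , p)

peak-u++d∷⁻ : ∀ P {Q x y} → ¬ StartsWithDown P → ¬ EndsWithUp P → Peak (u ∷ P ++ d ∷ Q) x y →
              (P ≡ [] × x ≡ 1 × y ≡ 1)
              ⊎ (∃ λ x′ → x ≡ suc x′ × Peak P x′ y)
              ⊎ (∃₂ λ x′ y′ → Peak Q x′ y′ × x ≡ suc (ups P + x′) × y ≡ downs P + suc y′)
peak-u++d∷⁻ P ¬start ¬end p with peak-u∷⁻ p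
peak-u++d∷⁻ [] _ _ _ | inj₁ (_ , refl , refl) = inj₁ (refl , refl , refl)
peak-u++d∷⁻ (d ∷ P) ¬start _ _ | inj₁ (start , _) = ⊥-elim (¬start start)
peak-u++d∷⁻ P ¬start ¬end _ | inj₂ (x′ , refl , p′) with peak-++⁻ P ¬end p′
... | inj₁ p″ = inj₂ (inj₁ (x′ , refl , p″))
... | inj₂ (x″ , _ , after-d {y = y″} q , refl , refl) = inj₂ (inj₂ (x″ , y″ , q , refl , refl))

ups-replicate-d++ : ∀ k Q → ups (replicate k d ++ Q) ≡ ups Q
ups-replicate-d++ zero Q = refl
ups-replicate-d++ (suc k) Q = ups-replicate-d++ k Q

downs-replicate-d++ : ∀ k Q → downs (replicate k d ++ Q) ≡ k + downs Q
downs-replicate-d++ zero Q = refl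
downs-replicate-d++ (suc k) Q = cong suc (downs-replicate-d++ k Q)

startsWithDown-replicate-d++ : ∀ k {Q} → ¬ StartsWithDown Q → StartsWithDown (replicate k d ++ Q) → k ≢ 0
startsWithDown-replicate-d++ zero ¬start start = λ _ → ¬start start
startsWithDown-replicate-d++ (suc k) _ _ = λ ()

peak-replicate-d++⁺ : ∀ k {Q x y} → Peak Q x y → Peak (replicate k d ++ Q) x (k + y)
peak-replicate-d++⁺ zero q = q
peak-replicate-d++⁺ (suc k) q = after-d (peak-replicate-d++⁺ k q)

peak-replicate-d++⁻ : ∀ k {Q x y} → Peak (replicate k d ++ Q) x y → ∃ λ y′ → y ≡ k + y′ × Peak Q x y′
peak-replicate-d++⁻ zero q = _ , refl , q
peak-replicate-d++⁻ (suc k) (after-d p) with peak-replicate-d++⁻ k p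
... | y′ , refl , q = y′ , refl , q

-- Right-to-left maxima and Krattenthaler's map

maxL-↭ : ∀ {xs ys} → xs ↭ ys → maxL xs ≡ maxL ys
maxL-↭ = PermutationProperties.foldr-commMonoid (setoid ℕ) ⊔-0-isCommutativeMonoid ∘ ↭⇒↭ₛ

maxL-∈ : ∀ x xs → maxL (x ∷ xs) ∈ x ∷ xs
maxL-∈ x [] = here (⊔-identityʳ x)
maxL-∈ x (y ∷ ys) with ⊔-sel x (maxL (y ∷ ys))
... | inj₁ x⊔m≡x = here x⊔m≡x
... | inj₂ x⊔m≡m = there (subst (_∈ y ∷ ys) (sym x⊔m≡m) (maxL-∈ y ys))

∈⇒≤maxL : ∀ {z} xs → z ∈ xs → z ≤ maxL xs
∈⇒≤maxL (x ∷ xs) (here refl) = m≤m⊔n x (maxL xs)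
∈⇒≤maxL (x ∷ xs) (there z∈xs) = ≤-trans (∈⇒≤maxL xs z∈xs) (m≤n⊔m x (maxL xs))

maxL<⇒All< : ∀ {x} xs → maxL xs < x → All (_< x) xs
maxL<⇒All< [] _ = []
maxL<⇒All< (y ∷ ys) h = m⊔n<o⇒m<o y (maxL ys) h ∷ maxL<⇒All< ys (m⊔n<o⇒n<o y (maxL ys) h)

All<⇒maxL< : ∀ {x} xs → 1 ≤ x → All (_< x) xs → maxL xs < x
All<⇒maxL< [] 1≤x _ = 1≤x
All<⇒maxL< (y ∷ ys) 1≤x (y<x ∷ ys<x) = ⊔-lub y<x (All<⇒maxL< ys 1≤x ys<x)

∸+≡⊔ : ∀ x m → x ∸ m + m ≡ x ⊔ m
∸+≡⊔ x m with ≤-total m x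
... | inj₁ m≤x = trans (m∸n+n≡m m≤x) (sym (m≥n⇒m⊔n≡m m≤x))
... | inj₂ x≤m = trans (cong (_+ m) (m≤n⇒m∸n≡0 x≤m)) (sym (m≤n⇒m⊔n≡n x≤m))

suc-⊔≡∸+suc : ∀ x m → suc (x ⊔ m) ≡ x ∸ m + suc m
suc-⊔≡∸+suc x m = trans (cong suc (sym (∸+≡⊔ x m))) (sym (+-suc (x ∸ m) m))

data RightMax : List ℕ → ℕ → ℕ → Set where
  here  : ∀ {x xs} → All (_< x) xs → RightMax (x ∷ xs) 1 x
  there : ∀ {x xs i a} → RightMax xs i a → RightMax (x ∷ xs) (suc i) a

rightMax-∈ : ∀ {w i a} → RightMax w i a → a ∈ w
rightMax-∈ (here _) = here refl
rightMax-∈ (there r) = there (rightMax-∈ r)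

rightMax-≤-maxL : ∀ {w i a} → RightMax w i a → a ≤ maxL w
rightMax-≤-maxL r = ∈⇒≤maxL _ (rightMax-∈ r)

rightMax-position : ∀ {w i a} → RightMax w i a → 1 ≤ i × i ≤ length w
rightMax-position (here _) = ≤-refl , s≤s z≤n
rightMax-position (there r) = s≤s z≤n , s≤s (proj₂ (rightMax-position r))

replicate-∷ʳ : ∀ {A : Set} k (a : A) → replicate k a ∷ʳ a ≡ a ∷ replicate k a
replicate-∷ʳ zero a = refl
replicate-∷ʳ (suc k) a = cong (a ∷_) (replicate-∷ʳ k a)

reflect-++ : ∀ P Q → reflect (P ++ Q) ≡ reflect Q ++ reflect P
reflect-++ P Q = trans (cong (map flipStep) (reverse-++ P Q)) (map-++ flipStep (reverse Q) (reverse P))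

reflect-replicate-u : ∀ k → reflect (replicate k u) ≡ replicate k d
reflect-replicate-u zero = refl
reflect-replicate-u (suc k) = begin
  reflect (u ∷ replicate k u)   ≡⟨ reflect-++ [ u ] (replicate k u) ⟩
  reflect (replicate k u) ∷ʳ d  ≡⟨ cong (_∷ʳ d) (reflect-replicate-u k) ⟩
  replicate k d ∷ʳ d            ≡⟨ replicate-∷ʳ k d ⟩
  replicate (suc k) d           ∎
  where open ≡-Reasoning

Kscan-∷ : ∀ c x xs → Kscan c (x ∷ xs) ≡ replicate (x ∸ c) u ++ d ∷ Kscan (c ⊔ x) xs
Kscan-∷ c x xs with c <ᵇ x | <ᵇ-reflects-< c x
... | true  | ofʸ c<x = cong (λ c′ → replicate (x ∸ c) u ++ d ∷ Kscan c′ xs) (sym (m≤n⇒m⊔n≡n (<⇒≤ c<x)))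
... | false | ofⁿ c≮x =
  cong₂ (λ k c′ → replicate k u ++ d ∷ Kscan c′ xs) (sym (m≤n⇒m∸n≡0 (≮⇒≥ c≮x))) (sym (m≥n⇒m⊔n≡m (≮⇒≥ c≮x)))

Kscan-∷ʳ : ∀ c ys x → Kscan c (ys ∷ʳ x) ≡ Kscan c ys ++ replicate (x ∸ (c ⊔ maxL ys)) u ++ [ d ]
Kscan-∷ʳ c [] x = trans (Kscan-∷ c x []) (cong (λ c′ → replicate (x ∸ c′) u ++ [ d ]) (sym (⊔-identityʳ c)))
Kscan-∷ʳ c (y ∷ ys) x = begin
  Kscan c (y ∷ ys ∷ʳ x)
    ≡⟨ Kscan-∷ c y (ys ∷ʳ x) ⟩
  rise ++ d ∷ Kscan (c ⊔ y) (ys ∷ʳ x)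
    ≡⟨ cong (λ P → rise ++ d ∷ P) (Kscan-∷ʳ (c ⊔ y) ys x) ⟩
  rise ++ d ∷ Kscan (c ⊔ y) ys ++ last (c ⊔ y ⊔ maxL ys)
    ≡⟨ cong (λ m → rise ++ d ∷ Kscan (c ⊔ y) ys ++ last m) (⊔-assoc c y (maxL ys)) ⟩
  rise ++ d ∷ Kscan (c ⊔ y) ys ++ last (c ⊔ maxL (y ∷ ys))
    ≡⟨ ++-assoc rise (d ∷ Kscan (c ⊔ y) ys) _ ⟨
  (rise ++ d ∷ Kscan (c ⊔ y) ys) ++ last (c ⊔ maxL (y ∷ ys))
    ≡⟨ cong (_++ last (c ⊔ maxL (y ∷ ys))) (Kscan-∷ c y ys) ⟨
  Kscan c (y ∷ ys) ++ last (c ⊔ maxL (y ∷ ys))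
    ∎
  where
  open ≡-Reasoning
  rise : List Step
  rise = replicate (y ∸ c) u
  last : ℕ → List Step
  last m = replicate (x ∸ m) u ++ [ d ]

K-∷ : ∀ x xs → K (x ∷ xs) ≡ u ∷ replicate (x ∸ maxL xs) d ++ K xs
K-∷ x xs = begin
  reflect (Kscan 0 (reverse (x ∷ xs)))
    ≡⟨ cong (reflect ∘ Kscan 0) (unfold-reverse x xs) ⟩
  reflect (Kscan 0 (reverse xs ∷ʳ x))
    ≡⟨ cong reflect (Kscan-∷ʳ 0 (reverse xs) x) ⟩
  reflect (Kscan 0 (reverse xs) ++ replicate (x ∸ m′) u ++ [ d ])
    ≡⟨ reflect-++ (Kscan 0 (reverse xs)) _ ⟩
  reflect (replicate (x ∸ m′) u ++ [ d ]) ++ K xs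
    ≡⟨ cong (_++ K xs) (reflect-++ (replicate (x ∸ m′) u) [ d ]) ⟩
  u ∷ reflect (replicate (x ∸ m′) u) ++ K xs
    ≡⟨ cong (λ P → u ∷ P ++ K xs) (reflect-replicate-u (x ∸ m′)) ⟩
  u ∷ replicate (x ∸ m′) d ++ K xs
    ≡⟨ cong (λ m → u ∷ replicate (x ∸ m) d ++ K xs) (maxL-↭ (↭-reverse xs)) ⟩
  u ∷ replicate (x ∸ maxL xs) d ++ K xs
    ∎
  where
  open ≡-Reasoning
  m′ : ℕ
  m′ = maxL (reverse xs)

ups-K : ∀ π → ups (K π) ≡ length π
ups-K [] = refl
ups-K (x ∷ xs) =
  trans (cong ups (K-∷ x xs)) (cong suc (trans (ups-replicate-d++ (x ∸ maxL xs) (K xs)) (ups-K xs)))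

downs-K : ∀ π → downs (K π) ≡ maxL π
downs-K [] = refl
downs-K (x ∷ xs) = begin
  downs (K (x ∷ xs))                           ≡⟨ cong downs (K-∷ x xs) ⟩
  downs (replicate (x ∸ maxL xs) d ++ K xs)    ≡⟨ downs-replicate-d++ (x ∸ maxL xs) (K xs) ⟩
  x ∸ maxL xs + downs (K xs)                   ≡⟨ cong (x ∸ maxL xs +_) (downs-K xs) ⟩
  x ∸ maxL xs + maxL xs                        ≡⟨ ∸+≡⊔ x (maxL xs) ⟩
  x ⊔ maxL xs                                  ∎
  where open ≡-Reasoning

¬startsWithDown-K : ∀ π → ¬ StartsWithDown (K π)
¬startsWithDown-K [] ()
¬startsWithDown-K (x ∷ xs) start = subst StartsWithDown (K-∷ x xs) start

-- The block u d^(x ∸ maxL xs) of x in K (x ∷ xs) carries a peak iff x > maxL xs, and the down-steps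
-- from there to the end of K (x ∷ xs) number x.
peak-K⁻ : ∀ π → All (1 ≤_) π → ∀ {x y} → Peak (K π) x y → RightMax π x (suc (maxL π) ∸ y)
peak-K⁻ (x ∷ xs) (_ ∷ xs≥1) p with peak-u∷⁻ (subst (λ P → Peak P _ _) (K-∷ x xs) p)
... | inj₁ (start , refl , refl) =
  subst (RightMax (x ∷ xs) 1) (sym (m≥n⇒m⊔n≡m (<⇒≤ m<x))) (here (maxL<⇒All< xs m<x))
  where
  m<x : maxL xs < x
  m<x = m∸n≢0⇒n<m (startsWithDown-replicate-d++ (x ∸ maxL xs) (¬startsWithDown-K xs) start)
... | inj₂ (x′ , refl , q) with peak-replicate-d++⁻ (x ∸ maxL xs) q
... | y′ , refl , q′ = subst (RightMax (x ∷ xs) (suc x′)) value (there (peak-K⁻ xs xs≥1 q′))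
  where
  value : suc (maxL xs) ∸ y′ ≡ suc (x ⊔ maxL xs) ∸ (x ∸ maxL xs + y′)
  value = trans (sym ([m+n]∸[m+o]≡n∸o (x ∸ maxL xs) (suc (maxL xs)) y′))
                (cong (_∸ (x ∸ maxL xs + y′)) (sym (suc-⊔≡∸+suc x (maxL xs))))

peak-K⁺ : ∀ π → All (1 ≤_) π → ∀ {i a} → RightMax π i a → Peak (K π) i (suc (maxL π) ∸ a)
peak-K⁺ (x ∷ xs) (x≥1 ∷ _) (here xs<x) =
  subst₂ (λ P y → Peak P 1 y) (sym (K-∷ x xs)) height (first-block (m<n⇒0<n∸m m<x))
  where
  m<x : maxL xs < x
  m<x = All<⇒maxL< xs x≥1 xs<x
  first-block : ∀ {k} → 1 ≤ k → Peak (u ∷ replicate k d ++ K xs) 1 1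
  first-block {suc k} _ = peak
  height : 1 ≡ suc (x ⊔ maxL xs) ∸ x
  height = sym (trans (cong (λ m → suc m ∸ x) (m≥n⇒m⊔n≡m (<⇒≤ m<x))) (m+n∸n≡m 1 x))
peak-K⁺ (x ∷ xs) (_ ∷ xs≥1) {suc i} {a} (there r) =
  subst₂ (λ P y → Peak P (suc i) y) (sym (K-∷ x xs)) height
    (after-u (peak-replicate-d++⁺ (x ∸ maxL xs) (peak-K⁺ xs xs≥1 r)))
  where
  height : x ∸ maxL xs + (suc (maxL xs) ∸ a) ≡ suc (x ⊔ maxL xs) ∸ a
  height = trans (sym (+-∸-assoc (x ∸ maxL xs) (m≤n⇒m≤1+n (rightMax-≤-maxL r))))
                 (cong (_∸ a) (sym (suc-⊔≡∸+suc x (maxL xs))))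

RMAX⇔RightMax : ∀ {w i a} → RMAX w i a ⇔ RightMax w i a
RMAX⇔RightMax = mk⇔ (λ { (p , refl , refl , h) → from-index _ p h }) to-index
  where
  from-index : ∀ w p → (∀ q → p Fin.< q → lookup w q < lookup w p) → RightMax w (suc (toℕ p)) (lookup w p)
  from-index (x ∷ xs) fzero h =
    here (All.tabulate λ z∈xs → subst (_< x) (sym (lookup-index z∈xs)) (h (fsuc (index z∈xs)) z<s))
  from-index (x ∷ xs) (fsuc p) h = there (from-index xs p (λ q p<q → h (fsuc q) (s<s p<q)))
  to-index : ∀ {w i a} → RightMax w i a → RMAX w i a
  to-index (here xs<x) = fzero , refl , refl , λ { (fsuc q) _ → All.lookup xs<x (∈-lookup q) }
  to-index (there r) with to-index r
  ... | p , refl , refl , h = fsuc p , refl , refl , λ { (fsuc q) (s<s p<q) → h q p<q }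

-- Left-to-right minima and 132-avoiding words

data LeftMin : List ℕ → ℕ → ℕ → Set where
  here  : ∀ {x xs} → LeftMin (x ∷ xs) 1 x
  there : ∀ {x xs i b} → b < x → LeftMin xs i b → LeftMin (x ∷ xs) (suc i) b

leftMin-∈ : ∀ {w i b} → LeftMin w i b → b ∈ w
leftMin-∈ here = here refl
leftMin-∈ (there _ lm) = there (leftMin-∈ lm)

leftMin-position : ∀ {w i b} → LeftMin w i b → 1 ≤ i × i ≤ length w
leftMin-position here = ≤-refl , s≤s z≤n
leftMin-position (there _ lm) = s≤s z≤n , s≤s (proj₂ (leftMin-position lm))

leftMin-++ˡ : ∀ {xs i b} ys → LeftMin xs i b → LeftMin (xs ++ ys) i b
leftMin-++ˡ ys here = here
leftMin-++ˡ ys (there b<x lm) = there b<x (leftMin-++ˡ ys lm)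

leftMin-++ʳ : ∀ xs {ys i b} → All (b <_) xs → LeftMin ys i b → LeftMin (xs ++ ys) (length xs + i) b
leftMin-++ʳ [] _ lm = lm
leftMin-++ʳ (x ∷ xs) (b<x ∷ b<xs) lm = there b<x (leftMin-++ʳ xs b<xs lm)

leftMin-++⁻ : ∀ xs {ys i b} → LeftMin (xs ++ ys) i b →
              LeftMin xs i b ⊎ (All (b <_) xs × ∃ λ i′ → i ≡ length xs + i′ × LeftMin ys i′ b)
leftMin-++⁻ [] lm = inj₂ ([] , _ , refl , lm)
leftMin-++⁻ (x ∷ xs) here = inj₁ here
leftMin-++⁻ (x ∷ xs) (there b<x lm) with leftMin-++⁻ xs lm
... | inj₁ lm′ = inj₁ (there b<x lm′)
... | inj₂ (b<xs , i′ , refl , lm′) = inj₂ (b<x ∷ b<xs , i′ , refl , lm′)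

LMIN⇔LeftMin : ∀ {w i b} → LMIN w i b ⇔ LeftMin w i b
LMIN⇔LeftMin = mk⇔ (λ { (p , refl , refl , h) → from-index _ p h }) to-index
  where
  from-index : ∀ w p → (∀ q → q Fin.< p → lookup w p < lookup w q) → LeftMin w (suc (toℕ p)) (lookup w p)
  from-index (x ∷ xs) fzero h = here
  from-index (x ∷ xs) (fsuc p) h = there (h fzero z<s) (from-index xs p (λ q q<p → h (fsuc q) (s<s q<p)))
  to-index : ∀ {w i b} → LeftMin w i b → LMIN w i b
  to-index here = fzero , refl , refl , λ q ()
  to-index (there b<x lm) with to-index lm
  ... | p , refl , refl , h = fsuc p , refl , refl , λ { fzero _ → b<x ; (fsuc q) (s<s q<p) → h q q<p }

data Precedes (y z : ℕ) : List ℕ → Set where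
  here  : ∀ {xs} → z ∈ xs → Precedes y z (y ∷ xs)
  there : ∀ {x xs} → Precedes y z xs → Precedes y z (x ∷ xs)

Avoids132′ : List ℕ → Set
Avoids132′ [] = ⊤
Avoids132′ (x ∷ xs) = (∀ {y z} → Precedes y z xs → ¬ (x < z × z < y)) × Avoids132′ xs

precedes⇒indices : ∀ {y z} xs → Precedes y z xs →
                   ∃₂ λ j k → j Fin.< k × lookup xs j ≡ y × lookup xs k ≡ z
precedes⇒indices (y ∷ xs) (here z∈xs) = fzero , fsuc (index z∈xs) , z<s , refl , sym (lookup-index z∈xs)
precedes⇒indices (x ∷ xs) (there pr) with precedes⇒indices xs pr
... | j , k , j<k , refl , refl = fsuc j , fsuc k , s<s j<k , refl , refl

Avoids132⇒Avoids132′ : ∀ w → Avoids132 w → Avoids132′ w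
Avoids132⇒Avoids132′ [] _ = tt
Avoids132⇒Avoids132′ (x ∷ xs) av = first , Avoids132⇒Avoids132′ xs tail-avoids
  where
  first : ∀ {y z} → Precedes y z xs → ¬ (x < z × z < y)
  first pr with precedes⇒indices xs pr
  ... | j , k , j<k , refl , refl = av fzero (fsuc j) (fsuc k) z<s (s<s j<k)
  tail-avoids : Avoids132 xs
  tail-avoids i j k i<j j<k = av (fsuc i) (fsuc j) (fsuc k) (s<s i<j) (s<s j<k)

precedes-++ˡ : ∀ {y z} xs {ys} → Precedes y z xs → Precedes y z (xs ++ ys)
precedes-++ˡ (_ ∷ xs) (here z∈xs) = here (∈-++⁺ˡ z∈xs)
precedes-++ˡ (_ ∷ xs) (there pr) = there (precedes-++ˡ xs pr)

precedes-++ʳ : ∀ {y z} xs {ys} → Precedes y z ys → Precedes y z (xs ++ ys)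
precedes-++ʳ [] pr = pr
precedes-++ʳ (x ∷ xs) pr = there (precedes-++ʳ xs pr)

Avoids132′-++⁻ : ∀ xs {ys} → Avoids132′ (xs ++ ys) → Avoids132′ xs × Avoids132′ ys
Avoids132′-++⁻ [] av = tt , av
Avoids132′-++⁻ (x ∷ xs) (first , av) with Avoids132′-++⁻ xs av
... | av-xs , av-ys = (first ∘ precedes-++ˡ xs , av-xs) , av-ys

avoids132′-across : ∀ l {m r a z} → Avoids132′ (l ++ m ∷ r) → a ∈ l → z ∈ r → ¬ (a < z × z < m)
avoids132′-across (a ∷ l) (first , _) (here refl) z∈r = first (precedes-++ʳ l (here z∈r))
avoids132′-across (_ ∷ l) (_ , av) (there a∈l) z∈r = avoids132′-across l av a∈l z∈r

Unique-++⁻ : ∀ (xs : List ℕ) {ys} → Unique (xs ++ ys) →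
             Unique xs × Unique ys × (∀ {a b} → a ∈ xs → b ∈ ys → a ≢ b)
Unique-++⁻ [] uniq = [] , uniq , λ ()
Unique-++⁻ (x ∷ xs) (x∉ ∷ uniq) with Unique-++⁻ xs uniq
... | uniq-xs , uniq-ys , disjoint = ++⁻ˡ xs x∉ ∷ uniq-xs , uniq-ys , across
  where
  across : ∀ {a b} → a ∈ x ∷ xs → b ∈ _ → a ≢ b
  across (here refl) b∈ys = All.lookup (++⁻ʳ xs x∉) b∈ys
  across (there a∈xs) b∈ys = disjoint a∈xs b∈ys

-- The shape of a 132-avoiding word with distinct letters around its maximum m.
record Layered (l : List ℕ) (m : ℕ) (r : List ℕ) : Set where
  field
    left<max   : ∀ {a} → a ∈ l → a < m
    right<max  : ∀ {z} → z ∈ r → z < m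
    right<left : ∀ {a z} → a ∈ l → z ∈ r → z < a
open Layered

layered : ∀ l m r → Unique (l ++ m ∷ r) → Avoids132′ (l ++ m ∷ r) → (∀ {z} → z ∈ l ++ m ∷ r → z ≤ m) →
          Layered l m r
layered l m r uniq av ≤m with Unique-++⁻ l uniq
... | _ , m∉r ∷ _ , disjoint = record
  { left<max   = λ a∈l → ≤∧≢⇒< (≤m (∈-++⁺ˡ a∈l)) (disjoint a∈l (here refl))
  ; right<max  = r<m
  ; right<left = λ a∈l z∈r → ≤∧≢⇒< (≮⇒≥ (λ a<z → avoids132′-across l av a∈l z∈r (a<z , r<m z∈r)))
                                   (disjoint a∈l (there z∈r) ∘ sym)
  }
  where
  r<m : ∀ {z} → z ∈ r → z < m
  r<m z∈r = ≤∧≢⇒< (≤m (∈-++⁺ʳ l (there z∈r))) (All.lookup m∉r z∈r ∘ sym)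

count≥ : ℕ → List ℕ → ℕ
count≥ b w = length (filter (b ≤?_) w)

count≥-++ : ∀ b xs ys → count≥ b (xs ++ ys) ≡ count≥ b xs + count≥ b ys
count≥-++ b xs ys = trans (cong length (filter-++ (b ≤?_) xs ys)) (length-++ (filter (b ≤?_) xs))

count≥-all : ∀ {b xs} → All (b ≤_) xs → count≥ b xs ≡ length xs
count≥-all {b} xs≥b = cong length (filter-all (b ≤?_) xs≥b)

count≥-none : ∀ {b xs} → All (_< b) xs → count≥ b xs ≡ 0
count≥-none {b} xs<b = cong length (filter-none (b ≤?_) (All.map <⇒≱ xs<b))

count≥-accept : ∀ {b x} xs → b ≤ x → count≥ b (x ∷ xs) ≡ suc (count≥ b xs)
count≥-accept {b} _ b≤x = cong length (filter-accept (b ≤?_) b≤x)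

count≥-reject : ∀ {b x} xs → ¬ b ≤ x → count≥ b (x ∷ xs) ≡ count≥ b xs
count≥-reject {b} _ b≰x = cong length (filter-reject (b ≤?_) b≰x)

module _ {l : List ℕ} {m : ℕ} {r : List ℕ} (L : Layered l m r) where

  count≥-layered-left : ∀ {b} → b ∈ l → count≥ b (l ++ m ∷ r) ≡ suc (count≥ b l)
  count≥-layered-left {b} b∈l = begin
    count≥ b (l ++ m ∷ r)           ≡⟨ count≥-++ b l (m ∷ r) ⟩
    count≥ b l + count≥ b (m ∷ r)   ≡⟨ cong (count≥ b l +_) (count≥-accept r (<⇒≤ (left<max L b∈l))) ⟩
    count≥ b l + suc (count≥ b r)   ≡⟨ cong (λ c → count≥ b l + suc c) (count≥-none r<b) ⟩
    count≥ b l + 1                  ≡⟨ +-comm (count≥ b l) 1 ⟩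
    suc (count≥ b l)                ∎
    where
    open ≡-Reasoning
    r<b : All (_< b) r
    r<b = All.tabulate (right<left L b∈l)

  count≥-layered-right : ∀ {b} → b ∈ r → count≥ b (l ++ m ∷ r) ≡ length l + suc (count≥ b r)
  count≥-layered-right {b} b∈r = trans (count≥-++ b l (m ∷ r))
    (cong₂ _+_ (count≥-all (All.tabulate (λ a∈l → <⇒≤ (right<left L a∈l b∈r))))
               (count≥-accept r (<⇒≤ (right<max L b∈r))))

  count≥-layered-max : l ≡ [] → count≥ m (l ++ m ∷ r) ≡ 1
  count≥-layered-max refl =
    trans (count≥-accept r ≤-refl) (cong suc (count≥-none (All.tabulate (right<max L))))

-- Peaks of the standard bijection f

PeaksAreLeftMins : List Step → List ℕ → Set
PeaksAreLeftMins P w = ∀ {x y} → Peak P x y → ∃ λ b → LeftMin w y b × x ≡ count≥ b w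

LeftMinsArePeaks : List Step → List ℕ → Set
LeftMinsArePeaks P w = ∀ {y b} → LeftMin w y b → Peak P (count≥ b w) y

length≡0⇒[] : ∀ {A : Set} (xs : List A) → length xs ≡ 0 → xs ≡ []
length≡0⇒[] [] _ = refl

-- Pl and Pr stand for f l and f r in f (l m r) = u f(l) d f(r).
module _ {l : List ℕ} {m : ℕ} {r : List ℕ} {Pl Pr : List Step}
         (L : Layered l m r) (ups≡ : ups Pl ≡ length l) (downs≡ : downs Pl ≡ length l) where

  private
    count≥-right : ∀ {b} → b ∈ r → suc (ups Pl + count≥ b r) ≡ count≥ b (l ++ m ∷ r)
    count≥-right {b} b∈r = trans (cong (λ k → suc (k + count≥ b r)) ups≡)
                                 (trans (sym (+-suc (length l) _)) (sym (count≥-layered-right L b∈r)))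

    position-right : ∀ i → downs Pl + suc i ≡ length l + suc i
    position-right i = cong (_+ suc i) downs≡

    leftMin-right : ∀ {i b} → LeftMin r i b → LeftMin (l ++ m ∷ r) (length l + suc i) b
    leftMin-right lm = leftMin-++ʳ l (All.tabulate (λ a∈l → right<left L a∈l (leftMin-∈ lm)))
                                     (there (right<max L (leftMin-∈ lm)) lm)

  peaks-node⁻ : ¬ StartsWithDown Pl → ¬ EndsWithUp Pl → PeaksAreLeftMins Pl l → PeaksAreLeftMins Pr r →
                PeaksAreLeftMins (u ∷ Pl ++ d ∷ Pr) (l ++ m ∷ r)
  peaks-node⁻ ¬start ¬end left right p with peak-u++d∷⁻ Pl ¬start ¬end p
  ... | inj₁ (refl , refl , refl) =
    m , subst (λ l′ → LeftMin (l′ ++ m ∷ r) 1 m) (sym l≡[]) here , sym (count≥-layered-max L l≡[])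
    where
    l≡[] : l ≡ []
    l≡[] = length≡0⇒[] l (sym ups≡)
  ... | inj₂ (inj₁ (_ , refl , pl)) with left pl
  ...   | b , lm , refl = b , leftMin-++ˡ (m ∷ r) lm , sym (count≥-layered-left L (leftMin-∈ lm))
  peaks-node⁻ ¬start ¬end left right p | inj₂ (inj₂ (_ , y′ , pr , refl , refl)) with right pr
  ...   | b , lm , refl =
    b , subst (λ i → LeftMin (l ++ m ∷ r) i b) (sym (position-right y′)) (leftMin-right lm) ,
    count≥-right (leftMin-∈ lm)

  peaks-node⁺ : LeftMinsArePeaks Pl l → LeftMinsArePeaks Pr r →
                LeftMinsArePeaks (u ∷ Pl ++ d ∷ Pr) (l ++ m ∷ r)
  peaks-node⁺ left right lm with leftMin-++⁻ l lm
  ... | inj₁ lm′ =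
    subst (λ x → Peak _ x _) (sym (count≥-layered-left L (leftMin-∈ lm′)))
      (after-u (peak-++ˡ (d ∷ Pr) (left lm′)))
  ... | inj₂ (m<l , _ , refl , here) =
    subst₂ (Peak _) (sym (count≥-layered-max L l≡[])) (cong (λ l′ → length l′ + 1) (sym l≡[])) first-peak
    where
    empty : ∀ {l′} → All (m <_) l′ → (∀ {a} → a ∈ l′ → a < m) → l′ ≡ []
    empty [] _ = refl
    empty (m<a ∷ _) <m = ⊥-elim (<-asym m<a (<m (here refl)))
    l≡[] : l ≡ []
    l≡[] = empty m<l (left<max L)
    Pl≡[] : Pl ≡ []
    Pl≡[] = ups-downs≡0⇒[] Pl (trans ups≡ (cong length l≡[])) (trans downs≡ (cong length l≡[]))
    first-peak : Peak (u ∷ Pl ++ d ∷ Pr) 1 1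
    first-peak = subst (λ P → Peak (u ∷ P ++ d ∷ Pr) 1 1) (sym Pl≡[]) peak
  ... | inj₂ (_ , _ , refl , there _ lm′) =
    subst₂ (Peak _) (count≥-right (leftMin-∈ lm′)) (position-right _)
      (after-u (peak-++ʳ Pl (after-d (right lm′))))

splitAt1-++ : ∀ {m} w → m ∈ w → w ≡ proj₁ (splitAt1 m w) ++ m ∷ proj₂ (splitAt1 m w)
splitAt1-++ {m} (x ∷ xs) m∈w with x ≡ᵇ m in eq
... | true = cong (_∷ xs) (≡ᵇ⇒≡ x m (subst T (sym eq) tt))
... | false with m∈w
...   | here m≡x = ⊥-elim (subst T eq (≡⇒≡ᵇ x m (sym m≡x)))
...   | there m∈xs = cong (x ∷_) (splitAt1-++ xs m∈xs)

module MaxSplit (x : ℕ) (xs : List ℕ) where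

  m : ℕ
  m = maxL (x ∷ xs)

  l r : List ℕ
  l = proj₁ (splitAt1 m (x ∷ xs))
  r = proj₂ (splitAt1 m (x ∷ xs))

  split : x ∷ xs ≡ l ++ m ∷ r
  split = splitAt1-++ (x ∷ xs) (maxL-∈ x xs)

  length-split : length (x ∷ xs) ≡ length l + suc (length r)
  length-split = trans (cong length split) (length-++ l)

  fuel-l : ∀ {k} → length (x ∷ xs) ≤ suc k → length l ≤ k
  fuel-l len≤ = ≤-pred (≤-trans (subst (length l <_) (sym length-split) (m<m+n (length l) z<s)) len≤)

  fuel-r : ∀ {k} → length (x ∷ xs) ≤ suc k → length r ≤ k
  fuel-r len≤ =
    ≤-pred (≤-trans (subst (length r <_) (sym length-split) (m≤n+m (suc (length r)) (length l))) len≤)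

  module _ (uniq : Unique (x ∷ xs)) (av : Avoids132′ (x ∷ xs)) where

    layered-split : Layered l m r
    layered-split = layered l m r (subst Unique split uniq) (subst Avoids132′ split av)
                      (subst (λ w → ∀ {z} → z ∈ w → z ≤ m) split (∈⇒≤maxL (x ∷ xs)))

    parts : (Unique l × Avoids132′ l) × (Unique r × Avoids132′ r)
    parts with Unique-++⁻ l (subst Unique split uniq) | Avoids132′-++⁻ l (subst Avoids132′ split av)
    ... | uniq-l , _ ∷ uniq-r , _ | av-l , _ , av-r = (uniq-l , av-l) , (uniq-r , av-r)

ups-fAux : ∀ k w → length w ≤ k → ups (fAux k w) ≡ length w
ups-fAux k [] _ = refl
ups-fAux (suc k) (x ∷ xs) len≤ = begin
  suc (ups (fAux k l ++ d ∷ fAux k r))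
    ≡⟨ cong suc (ups-++ (fAux k l) (d ∷ fAux k r)) ⟩
  suc (ups (fAux k l) + ups (fAux k r))
    ≡⟨ cong suc (cong₂ _+_ (ups-fAux k l (fuel-l len≤)) (ups-fAux k r (fuel-r len≤))) ⟩
  suc (length l + length r)
    ≡⟨ trans length-split (+-suc (length l) (length r)) ⟨
  length (x ∷ xs)
    ∎
  where
  open ≡-Reasoning
  open MaxSplit x xs

downs-fAux : ∀ k w → length w ≤ k → downs (fAux k w) ≡ length w
downs-fAux k [] _ = refl
downs-fAux (suc k) (x ∷ xs) len≤ = begin
  downs (fAux k l ++ d ∷ fAux k r)
    ≡⟨ downs-++ (fAux k l) (d ∷ fAux k r) ⟩
  downs (fAux k l) + suc (downs (fAux k r))
    ≡⟨ cong₂ (λ a b → a + suc b) (downs-fAux k l (fuel-l len≤)) (downs-fAux k r (fuel-r len≤)) ⟩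
  length l + suc (length r)
    ≡⟨ length-split ⟨
  length (x ∷ xs)
    ∎
  where
  open ≡-Reasoning
  open MaxSplit x xs

¬startsWithDown-fAux : ∀ k w → ¬ StartsWithDown (fAux k w)
¬startsWithDown-fAux k [] ()
¬startsWithDown-fAux zero (_ ∷ _) ()
¬startsWithDown-fAux (suc k) (_ ∷ _) ()

¬endsWithUp-fAux : ∀ k w → ¬ EndsWithUp (fAux k w)
¬endsWithUp-fAux k [] ()
¬endsWithUp-fAux zero (_ ∷ _) ()
¬endsWithUp-fAux (suc k) (x ∷ xs) e =
  ¬endsWithUp-fAux k r (endsWithUp-d∷⁻ (fAux k r) (endsWithUp-++⁻ (u ∷ fAux k l) e))
  where open MaxSplit x xs

peaks-fAux⁻ : ∀ k w → length w ≤ k → Unique w → Avoids132′ w → PeaksAreLeftMins (fAux k w) w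
peaks-fAux⁻ k [] _ _ _ ()
peaks-fAux⁻ (suc k) (x ∷ xs) len≤ uniq av with MaxSplit.parts x xs uniq av
... | (uniq-l , av-l) , (uniq-r , av-r) =
  subst (PeaksAreLeftMins (fAux (suc k) (x ∷ xs))) (sym split)
    (peaks-node⁻ (layered-split uniq av) (ups-fAux k l (fuel-l len≤)) (downs-fAux k l (fuel-l len≤))
      (¬startsWithDown-fAux k l) (¬endsWithUp-fAux k l)
      (peaks-fAux⁻ k l (fuel-l len≤) uniq-l av-l) (peaks-fAux⁻ k r (fuel-r len≤) uniq-r av-r))
  where open MaxSplit x xs

peaks-fAux⁺ : ∀ k w → length w ≤ k → Unique w → Avoids132′ w → LeftMinsArePeaks (fAux k w) w
peaks-fAux⁺ k [] _ _ _ ()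
peaks-fAux⁺ (suc k) (x ∷ xs) len≤ uniq av with MaxSplit.parts x xs uniq av
... | (uniq-l , av-l) , (uniq-r , av-r) =
  subst (LeftMinsArePeaks (fAux (suc k) (x ∷ xs))) (sym split)
    (peaks-node⁺ (layered-split uniq av) (ups-fAux k l (fuel-l len≤)) (downs-fAux k l (fuel-l len≤))
      (peaks-fAux⁺ k l (fuel-l len≤) uniq-l av-l) (peaks-fAux⁺ k r (fuel-r len≤) uniq-r av-r))
  where open MaxSplit x xs

-- Permutations of [n]

InRange : ℕ → ℕ → Set
InRange n x = 1 ≤ x × x ≤ n

flip-range : ∀ {n x} → InRange n x → InRange n (n + 1 ∸ x)
flip-range {n} {x} (1≤x , x≤n) =
  m<n⇒0<n∸m (≤-<-trans x≤n (m<m+n n z<s)) , ≤-trans (∸-monoʳ-≤ (n + 1) 1≤x) (≤-reflexive (m+n∸n≡m n 1))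

flip-range⁻ : ∀ {n x} → InRange n (n + 1 ∸ x) → InRange n x
flip-range⁻ {n} {x} (1≤x′ , x′≤n) =
  n≢0⇒n>0 x≢0 , ≤-pred (≤-trans (m∸n≢0⇒n<m (n>0⇒n≢0 1≤x′)) (≤-reflexive (+-comm n 1)))
  where
  x≢0 : x ≢ 0
  x≢0 refl = 1+n≰n (subst (_≤ n) (+-comm n 1) x′≤n)

flip-flip : ∀ {n x} → x ≤ n → n + 1 ∸ (n + 1 ∸ x) ≡ x
flip-flip {n} x≤n = m∸[m∸n]≡n (≤-trans x≤n (m≤m+n n 1))

flip-reindex : ∀ n (R L : ℕ → ℕ → Set) →
  (∀ {x v} → R x v → InRange n x × InRange n v) → (∀ {y v} → L y v → InRange n y × InRange n v) →
  (∀ x y → L y (n + 1 ∸ x) ⇔ R x (n + 1 ∸ y)) ⇔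
  (∀ i a → 1 ≤ i → i ≤ n → 1 ≤ a → a ≤ n → R (n + 1 ∸ i) a ⇔ L (n + 1 ∸ a) i)
flip-reindex n R L R-range L-range = mk⇔ to from
  where
  Pointwise Boxed : Set
  Pointwise = ∀ x y → L y (n + 1 ∸ x) ⇔ R x (n + 1 ∸ y)
  Boxed = ∀ i a → 1 ≤ i → i ≤ n → 1 ≤ a → a ≤ n → R (n + 1 ∸ i) a ⇔ L (n + 1 ∸ a) i

  to : Pointwise → Boxed
  to h i a _ i≤n _ a≤n =
    ⇔-sym (subst₂ (λ i′ a′ → L (n + 1 ∸ a) i′ ⇔ R (n + 1 ∸ i) a′) (flip-flip i≤n) (flip-flip a≤n)
                  (h (n + 1 ∸ i) (n + 1 ∸ a)))

  boxed-at : Boxed → ∀ {x y} → InRange n x → InRange n y → R x (n + 1 ∸ y) ⇔ L y (n + 1 ∸ x)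
  boxed-at H {x} {y} x∈ y∈ with flip-range x∈ | flip-range y∈
  ... | 1≤i , i≤n | 1≤a , a≤n =
    subst₂ (λ x′ y′ → R x′ (n + 1 ∸ y) ⇔ L y′ (n + 1 ∸ x)) (flip-flip (proj₂ x∈)) (flip-flip (proj₂ y∈))
           (H (n + 1 ∸ x) (n + 1 ∸ y) 1≤i i≤n 1≤a a≤n)

  -- Each direction reads the ranges of x and y off its own premise.
  from : Boxed → Pointwise
  from H x y = mk⇔
    (λ lyx → let y∈ , x′∈ = L-range lyx in Equivalence.from (boxed-at H (flip-range⁻ x′∈) y∈) lyx)
    (λ rxy → let x∈ , y′∈ = R-range rxy in Equivalence.to (boxed-at H x∈ (flip-range⁻ y′∈)) rxy)

module Permutation {n w} (perm : IsPerm n w) where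

  private
    descending : w ↭ map suc (downFrom n)
    descending = ↭-trans perm (map⁺ suc (↭-trans (↭-sym (↭-reverse (upTo n))) (↭-reflexive (reverse-upTo n))))

    range-desc : ∀ n {z} → z ∈ map suc (downFrom n) → InRange n z
    range-desc (suc n) (here refl) = s≤s z≤n , ≤-refl
    range-desc (suc n) (there z∈) = map₂ m≤n⇒m≤1+n (range-desc n z∈)

    maxL-desc : ∀ n → maxL (map suc (downFrom n)) ≡ n
    maxL-desc zero = refl
    maxL-desc (suc n) = trans (cong (suc n ⊔_) (maxL-desc n)) (m≥n⇒m⊔n≡m (n≤1+n n))

    count≥-desc : ∀ n {b} → 1 ≤ b → count≥ b (map suc (downFrom n)) ≡ suc n ∸ b
    count≥-desc zero {suc b} _ = sym (0∸n≡0 b)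
    count≥-desc (suc n) {b} 1≤b with b ≤? suc n
    ... | yes b≤ = trans (count≥-accept _ b≤) (trans (cong suc (count≥-desc n 1≤b)) (sym (+-∸-assoc 1 b≤)))
    ... | no b≰ = trans (count≥-reject _ b≰)
                    (trans (count≥-desc n 1≤b) (trans (m≤n⇒m∸n≡0 (<⇒≤ (≰⇒> b≰))) (sym (m≤n⇒m∸n≡0 (≰⇒> b≰)))))

  length≡ : length w ≡ n
  length≡ = trans (↭-length descending) (trans (length-map suc (downFrom n)) (length-downFrom n))

  range : ∀ {z} → z ∈ w → InRange n z
  range z∈w = range-desc n (∈-resp-↭ descending z∈w)

  positive : All (1 ≤_) w
  positive = All.tabulate (proj₁ ∘ range)

  unique : Unique w
  unique = PermutationProperties.Unique-resp-↭ (setoid ℕ) (↭⇒↭ₛ (↭-sym descending))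
             (Unique.map⁺ suc-injective (Unique.downFrom⁺ n))

  maxL≡ : maxL w ≡ n
  maxL≡ = trans (maxL-↭ descending) (maxL-desc n)

  count≥≡ : ∀ {b} → b ∈ w → count≥ b w ≡ n + 1 ∸ b
  count≥≡ {b} b∈w = begin
    count≥ b w                        ≡⟨ ↭-length (filter-↭ (b ≤?_) descending) ⟩
    count≥ b (map suc (downFrom n))   ≡⟨ count≥-desc n (proj₁ (range b∈w)) ⟩
    suc n ∸ b                         ≡⟨ cong (_∸ b) (+-comm 1 n) ⟩
    n + 1 ∸ b                         ∎
    where open ≡-Reasoning

  RMAX-range : ∀ {x v} → RMAX w x v → InRange n x × InRange n v
  RMAX-range rmax = let r = Equivalence.to RMAX⇔RightMax rmax in
    subst (λ k → InRange k _) length≡ (rightMax-position r) , range (rightMax-∈ r)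

  LMIN-range : ∀ {y v} → LMIN w y v → InRange n y × InRange n v
  LMIN-range lmin = let lm = Equivalence.to LMIN⇔LeftMin lmin in
    subst (λ k → InRange k _) length≡ (leftMin-position lm) , range (leftMin-∈ lm)

  peaks-K : ∀ x y → Peak (K w) x y ⇔ RMAX w x (n + 1 ∸ y)
  peaks-K x y = mk⇔ to from
    where
    suc-maxL : suc (maxL w) ≡ n + 1
    suc-maxL = trans (cong suc maxL≡) (+-comm 1 n)
    to : Peak (K w) x y → RMAX w x (n + 1 ∸ y)
    to p = Equivalence.from RMAX⇔RightMax (subst (λ k → RightMax w x (k ∸ y)) suc-maxL (peak-K⁻ w positive p))
    from : RMAX w x (n + 1 ∸ y) → Peak (K w) x y
    from rmax = subst (Peak (K w) x) (flip-flip (proj₂ (flip-range⁻ (range (rightMax-∈ r)))))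
                  (subst (λ k → Peak (K w) x (k ∸ (n + 1 ∸ y))) suc-maxL (peak-K⁺ w positive r))
      where
      r : RightMax w x (n + 1 ∸ y)
      r = Equivalence.to RMAX⇔RightMax rmax

  peaks-f : Avoids132 w → ∀ x y → Peak (f w) x y ⇔ LMIN w y (n + 1 ∸ x)
  peaks-f av x y = mk⇔ to from
    where
    av′ : Avoids132′ w
    av′ = Avoids132⇒Avoids132′ w av
    to : Peak (f w) x y → LMIN w y (n + 1 ∸ x)
    to p with peaks-fAux⁻ (length w) w ≤-refl unique av′ p
    ... | b , lm , refl = Equivalence.from LMIN⇔LeftMin (subst (LeftMin w y) (sym b≡) lm)
      where
      b≡ : n + 1 ∸ count≥ b w ≡ b
      b≡ = trans (cong (n + 1 ∸_) (count≥≡ (leftMin-∈ lm))) (flip-flip (proj₂ (range (leftMin-∈ lm))))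
    from : LMIN w y (n + 1 ∸ x) → Peak (f w) x y
    from lmin = subst (λ k → Peak (f w) k y) x≡ (peaks-fAux⁺ (length w) w ≤-refl unique av′ lm)
      where
      lm : LeftMin w y (n + 1 ∸ x)
      lm = Equivalence.to LMIN⇔LeftMin lmin
      x≡ : count≥ (n + 1 ∸ x) w ≡ x
      x≡ = trans (count≥≡ (leftMin-∈ lm)) (flip-flip (proj₂ (flip-range⁻ (range (leftMin-∈ lm)))))

lemma6 : (n : ℕ) → 1 ≤ n → (π σ : List ℕ) →
         IsPerm n π → Avoids123 π → IsPerm n σ → Avoids132 σ →
         (f σ ≡ K π) ⇔
         ((i a : ℕ) → 1 ≤ i → i ≤ n → 1 ≤ a → a ≤ n →
            (RMAX π (n + 1 ∸ i) a ⇔ LMIN σ (n + 1 ∸ a) i))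
lemma6 n _ π σ π-perm _ σ-perm σ-avoids =
  flip-reindex n (RMAX π) (LMIN σ) π.RMAX-range σ.LMIN-range
    ⇔-∘ (peaks-correspond ⇔-∘ ≡⇔samePeaks (f σ) (K π) ups≡ downs≡)
  where
  module π = Permutation π-perm
  module σ = Permutation σ-perm

  ups≡ : ups (f σ) ≡ ups (K π)
  ups≡ = trans (ups-fAux (length σ) σ ≤-refl) (trans σ.length≡ (trans (sym π.length≡) (sym (ups-K π))))

  downs≡ : downs (f σ) ≡ downs (K π)
  downs≡ = trans (downs-fAux (length σ) σ ≤-refl) (trans σ.length≡ (trans (sym π.maxL≡) (sym (downs-K π))))

  peaks-correspond : (∀ x y → Peak (f σ) x y ⇔ Peak (K π) x y) ⇔
                     (∀ x y → LMIN σ y (n + 1 ∸ x) ⇔ RMAX π x (n + 1 ∸ y))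
  peaks-correspond = mk⇔
    (λ same x y → π.peaks-K x y ⇔-∘ (same x y ⇔-∘ ⇔-sym (σ.peaks-f σ-avoids x y)))
    (λ same x y → ⇔-sym (π.peaks-K x y) ⇔-∘ (same x y ⇔-∘ σ.peaks-f σ-avoids x y))
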